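{- Let $\mathbb{A}$ be a finite idempotent algebra omitting type $\mathbf{1}$ with fixed operation $\cdot$ as in the context. Let $ab$ be a (thick) semilattice edge, let $\theta$ be the congruence of $\mathrm{Sg}(a,b)$ witnessing this, oriented from $a$ to $b$ (i.e. $a^\theta\cdot b^\theta=b^\theta\cdot a^\theta=b^\theta$), and let $c\in a^\theta$. Then there is $d\in b^\theta$ such that $cd$ is a thin semilattice edge.
   Context: Types are in the sense of tame congruence theory. $\mathrm{Sg}(a,b)$ is the subalgebra generated by $\{a,b\}$, $a^\theta$ the $\theta$-block, $t/\theta$ the induced operation. $ab$ is an edge if there are a congruence $\theta$ of $\mathrm{Sg}(a,b)$ and a term operation $t$ such that $t/\theta$ is a binary semilattice operation on $\{a^\theta,b^\theta\}$ (semilattice type, $\theta$ witnesses it), or a ternary majority operation on $\{a^\theta,b^\theta\}$ (majority type), or an affine operation $x-y+z$ on $\mathrm{Sg}(a,b)/\theta$ (affine type). $\theta_{ab}$ is the smallest congruence certifying the type of $ab$; strict semilattice = semilattice type, strict majority = majority but not semilattice, strict affine = affine but neither. The operation $\cdot$ (write $x\cdot y=xy$) is a fixed binary term operation such that: for every edge $ab$, with $\theta=\theta_{ab}$, $\cdot/\theta$ restricted to $\{a^\theta,b^\theta\}$ is a semilattice operation if $ab$ is strict semilattice and the first projection if $ab$ is strict majority or strict affine; $x(xy)=xy$ for all $x,y$; and for all $a,b$ either $ab=a$ or, with $c=ab$, $ac$ is a semilattice edge with $\theta_{ac}$ the equality relation and $ac=ca=c$. A thin semilattice edge is a semilattice edge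 $ab$ with $\theta_{ab}$ the equality relation; it is directed from $a$ to $b$ when $ab=ba=b$, written $a\le b$. -}

module Defs where

open import Data.Nat using (ℕ; suc; _+_)
open import Data.Fin using (Fin; zero; suc)
open import Data.Bool using (Bool; T)
open import Data.Product using (Σ; ∃; ∃-syntax; _×_; _,_; proj₁)
open import Data.Sum using (_⊎_)
open import Relation.Nullary using (¬_)
open import Relation.Binary.PropositionalEquality using (_≡_)
open import Data.Vec.Functional using (_++_)
open import Algebra.Structures using (IsAbelianGroup)

-- A finite algebra: universe Fin size (every finite algebra is isomorphic
-- to one of this form), an arbitrary set of basic operation symbols with
-- arities, and their interpretations.

record Algebra : Set₁ where
  field
    size  : ℕ
    Op    : Set
    arity : Op → ℕ
    ⟦_⟧   : (o : Op) → (Fin (arity o) → Fin size) → Fin size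

module Theory (𝔸 : Algebra) where
  open Algebra 𝔸

  A : Set
  A = Fin size

  data Term (k : ℕ) : Set where
    var : Fin k → Term k
    app : (o : Op) → (Fin (arity o) → Term k) → Term k

  eval : ∀ {k} → Term k → (Fin k → A) → A
  eval (var i)    ρ = ρ i
  eval (app o ts) ρ = ⟦ o ⟧ (λ i → eval (ts i) ρ)

  infix 30 _⟨_,_⟩ _⟨_∣_∣_⟩
  _⟨_,_⟩ : Term 2 → A → A → A
  t ⟨ x , y ⟩ = eval t (λ { zero → x ; (suc _) → y })

  _⟨_∣_∣_⟩ : Term 3 → A → A → A → A
  t ⟨ x ∣ y ∣ z ⟩ = eval t (λ { zero → x ; (suc zero) → y ; (suc (suc _)) → z })

  Idempotent : Set
  Idempotent = ∀ (o : Op) (x : A) → ⟦ o ⟧ (λ _ → x) ≡ x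

  Pred : Set₁
  Pred = A → Set

  IsSubuniverse : Pred → Set
  IsSubuniverse P = ∀ (o : Op) (xs : Fin (arity o) → A) → (∀ i → P (xs i)) → P (⟦ o ⟧ xs)

  data Sg (a b : A) : A → Set where
    gen₁ : Sg a b a
    gen₂ : Sg a b b
    op   : ∀ (o : Op) (xs : Fin (arity o) → A) → (∀ i → Sg a b (xs i)) → Sg a b (⟦ o ⟧ xs)

  Rel : Set
  Rel = A → A → Bool

  infix 4 [_]_∼_
  [_]_∼_ : Rel → A → A → Set
  [ θ ] x ∼ y = T (θ x y)

  _⊆ʳ_ : Rel → Rel → Set
  α ⊆ʳ β = ∀ x y → [ α ] x ∼ y → [ β ] x ∼ y

  record IsCongruence (P : Pred) (θ : Rel) : Set where
    field
      onP        : ∀ x y → [ θ ] x ∼ y → P x × P y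
      reflexive  : ∀ x → P x → [ θ ] x ∼ x
      symmetric  : ∀ x y → [ θ ] x ∼ y → [ θ ] y ∼ x
      transitive : ∀ x y z → [ θ ] x ∼ y → [ θ ] y ∼ z → [ θ ] x ∼ z
      compatible : ∀ (o : Op) (xs ys : Fin (arity o) → A) →
                   (∀ i → [ θ ] xs i ∼ ys i) → [ θ ] ⟦ o ⟧ xs ∼ ⟦ o ⟧ ys

  InBlocks : Rel → A → A → A → Set
  InBlocks θ a b x = [ θ ] a ∼ x ⊎ [ θ ] b ∼ x

  SemilatticeOn : Rel → A → A → Term 2 → Set
  SemilatticeOn θ a b t =
    ∀ x y z → InBlocks θ a b x → InBlocks θ a b y → InBlocks θ a b z →
      InBlocks θ a b (t ⟨ x , y ⟩)
      × [ θ ] t ⟨ x , x ⟩ ∼ x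
      × [ θ ] t ⟨ x , y ⟩ ∼ t ⟨ y , x ⟩
      × [ θ ] t ⟨ t ⟨ x , y ⟩ , z ⟩ ∼ t ⟨ x , t ⟨ y , z ⟩ ⟩

  MajorityOn : Rel → A → A → Term 3 → Set
  MajorityOn θ a b t =
    (∀ x y z → InBlocks θ a b x → InBlocks θ a b y → InBlocks θ a b z →
      InBlocks θ a b (t ⟨ x ∣ y ∣ z ⟩))
    × (∀ x y → InBlocks θ a b x → InBlocks θ a b y →
      [ θ ] t ⟨ x ∣ x ∣ y ⟩ ∼ x × [ θ ] t ⟨ x ∣ y ∣ x ⟩ ∼ x × [ θ ] t ⟨ y ∣ x ∣ x ⟩ ∼ x)

  SgEl : A → A → Set
  SgEl a b = Σ A (Sg a b)

  -- t/θ is the affine operation x - y + z of some abelian group structure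
  -- on Sg(a,b)/θ (the group is given on representatives, with equality θ)
  AffineOn : Rel → A → A → Term 3 → Set
  AffineOn θ a b t =
    Σ (SgEl a b → SgEl a b → SgEl a b) λ _+ᵍ_ →
    Σ (SgEl a b) λ 0ᵍ →
    Σ (SgEl a b → SgEl a b) λ -ᵍ_ →
      IsAbelianGroup (λ x y → [ θ ] proj₁ x ∼ proj₁ y) _+ᵍ_ 0ᵍ -ᵍ_
      × (∀ x y z → [ θ ] t ⟨ proj₁ x ∣ proj₁ y ∣ proj₁ z ⟩ ∼ proj₁ ((x +ᵍ (-ᵍ y)) +ᵍ z))

  CertSL CertMaj CertAff : A → A → Rel → Set
  CertSL  a b θ = IsCongruence (Sg a b) θ × ¬ [ θ ] a ∼ b × ∃[ t ] SemilatticeOn θ a b t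
  CertMaj a b θ = IsCongruence (Sg a b) θ × ¬ [ θ ] a ∼ b × ∃[ t ] MajorityOn θ a b t
  CertAff a b θ = IsCongruence (Sg a b) θ × ¬ [ θ ] a ∼ b × ∃[ t ] AffineOn θ a b t

  SLEdge MajEdge AffEdge Edge : A → A → Set
  SLEdge  a b = ∃[ θ ] CertSL a b θ
  MajEdge a b = ∃[ θ ] CertMaj a b θ
  AffEdge a b = ∃[ θ ] CertAff a b θ
  Edge    a b = SLEdge a b ⊎ MajEdge a b ⊎ AffEdge a b

  StrictMaj StrictAff : A → A → Set
  StrictMaj a b = MajEdge a b × ¬ SLEdge a b
  StrictAff a b = AffEdge a b × ¬ SLEdge a b × ¬ MajEdge a b

  CertType : A → A → Rel → Set
  CertType a b θ =
    (SLEdge a b × CertSL a b θ) ⊎ (StrictMaj a b × CertMaj a b θ) ⊎ (StrictAff a b × CertAff a b θ)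

  IsθOf : A → A → Rel → Set
  IsθOf a b θ = CertType a b θ × (∀ θ' → CertType a b θ' → θ ⊆ʳ θ')

  ThinSL : A → A → Set
  ThinSL a b = SLEdge a b × ∃[ θ ] (IsθOf a b θ × (∀ x y → [ θ ] x ∼ y → x ≡ y))

  -- The fixed binary term operation · (given by a binary term d)

  DotAxioms : Term 2 → Set
  DotAxioms d =
    (∀ a b → Edge a b → ∀ θ → IsθOf a b θ →
       (SLEdge a b → SemilatticeOn θ a b d)
       × (StrictMaj a b ⊎ StrictAff a b →
           ∀ x y → InBlocks θ a b x → InBlocks θ a b y → [ θ ] d ⟨ x , y ⟩ ∼ x))
    × (∀ x y → d ⟨ x , d ⟨ x , y ⟩ ⟩ ≡ d ⟨ x , y ⟩)
    × (∀ a b → d ⟨ a , b ⟩ ≡ a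
               ⊎ (ThinSL a (d ⟨ a , b ⟩)
                  × d ⟨ a , d ⟨ a , b ⟩ ⟩ ≡ d ⟨ a , b ⟩
                  × d ⟨ d ⟨ a , b ⟩ , a ⟩ ≡ d ⟨ a , b ⟩))

  module TCT (P : Pred) where

    -- k-ary polynomial operations of the subalgebra with universe P:
    -- a term with k + m variables and m constants from P
    Poly : ℕ → Set
    Poly k = Σ ℕ λ m → Term (k + m) × Σ (Fin m → A) λ cs → ∀ j → P (cs j)

    evalP : ∀ {k} → Poly k → (Fin k → A) → A
    evalP (m , t , cs , _) xs = eval t (xs ++ cs)

    Range : Poly 1 → Pred
    Range p x = ∃[ y ] (P y × evalP p (λ _ → y) ≡ x)

    Separates : Rel → Rel → Poly 1 → Set
    Separates α β p = ∃[ x ] ∃[ y ] ([ β ] x ∼ y × ¬ [ α ] evalP p (λ _ → x) ∼ evalP p (λ _ → y))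

    MinimalRange : Rel → Rel → Poly 1 → Set
    MinimalRange α β p =
      Separates α β p
      × (∀ (q : Poly 1) → Separates α β q → (∀ x → Range q x → Range p x) → ∀ x → Range p x → Range q x)

    Prime : Rel → Rel → Set
    Prime α β =
      IsCongruence P α × IsCongruence P β × α ⊆ʳ β
      × (∃[ x ] ∃[ y ] ([ β ] x ∼ y × ¬ [ α ] x ∼ y))
      × (∀ γ → IsCongruence P γ → α ⊆ʳ γ → γ ⊆ʳ β → γ ⊆ʳ α ⊎ β ⊆ʳ γ)

    -- typ(α,β) = 1: for some minimal set U = p(P) and some trace N = U ∩ u^β
    -- (not contained in an α-block), the induced algebra A|N / α|N is
    -- essentially unary
    TypeOne : Rel → Rel → Set
    TypeOne α β =
      ∃[ p ] ∃[ u ] (MinimalRange α β p × Range p u ×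
        (let N : Pred
             N x = Range p x × [ β ] u ∼ x
         in (∃[ x ] ∃[ y ] (N x × N y × ¬ [ α ] x ∼ y))
            × (∀ k (f : Poly (suc k)) →
                 (∀ xs → (∀ i → N (xs i)) → N (evalP f xs)) →
                 ∃[ i ] ∀ xs ys → (∀ j → N (xs j)) → (∀ j → N (ys j)) →
                   [ α ] xs i ∼ ys i → [ α ] evalP f xs ∼ evalP f ys)))

  -- no subalgebra of A (hence, by the correspondence theorem, no algebra in
  -- HS(A)) has a prime quotient of type 1
  OmitsType1 : Set₁
  OmitsType1 = ∀ (P : Pred) → IsSubuniverse P → ∀ α β → TCT.Prime P α β → ¬ TCT.TypeOne P α β

-- The witness is c·b. Since c θ a, compatibility gives c·b θ a·b θ b.
-- By the axioms of ·, either c·b = c, which would put c, hence a, in b^θ,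
-- or c(c·b) is a thin semilattice edge.
module Submission where

open import Defs
open import Data.Product using (∃-syntax; _×_; _,_)
open import Data.Sum using (inj₁; inj₂)
open import Data.Fin using (Fin; zero; suc)
open import Data.Empty using (⊥-elim)
open import Relation.Binary.PropositionalEquality using (_≢_; subst)

module _ (𝔸 : Algebra) where
  open Theory 𝔸

  module _ {P : Pred} {θ : Rel} (congruence : IsCongruence P θ) where
    open IsCongruence congruence

    eval-compatible : ∀ {k} (t : Term k) (ρ σ : Fin k → A) →
      (∀ i → [ θ ] ρ i ∼ σ i) → [ θ ] eval t ρ ∼ eval t σ
    eval-compatible (var i)    ρ σ ρ∼σ = ρ∼σ i
    eval-compatible (app o ts) ρ σ ρ∼σ =
      compatible o _ _ (λ i → eval-compatible (ts i) ρ σ ρ∼σ)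

    binary-compatible : ∀ (t : Term 2) {x x′ y y′} →
      [ θ ] x ∼ x′ → [ θ ] y ∼ y′ → [ θ ] t ⟨ x , y ⟩ ∼ t ⟨ x′ , y′ ⟩
    binary-compatible t x∼x′ y∼y′ =
      eval-compatible t _ _ λ { zero → x∼x′ ; (suc _) → y∼y′ }

  thin-if-dot-moves : (d : Term 2) → DotAxioms d →
    ∀ x y → d ⟨ x , y ⟩ ≢ x → ThinSL x (d ⟨ x , y ⟩)
  thin-if-dot-moves d (_ , _ , fixed-or-thin) x y moves with fixed-or-thin x y
  ... | inj₁ fixed          = ⊥-elim (moves fixed)
  ... | inj₂ (thin , _ , _) = thin

lemma11 : (𝔸 : Algebra) → let open Theory 𝔸 in
    Idempotent → OmitsType1 →
    (d : Term 2) → DotAxioms d →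
    (a b : A) (θ : Rel) → CertSL a b θ →
    [ θ ] d ⟨ a , b ⟩ ∼ b → [ θ ] d ⟨ b , a ⟩ ∼ b →
    (c : A) → [ θ ] a ∼ c →
    ∃[ e ] ([ θ ] b ∼ e × ThinSL c e)
lemma11 𝔸 _ _ d axioms a b θ (congruence , a≁b , _) ab∼b _ c a∼c =
  d ⟨ c , b ⟩ , symmetric _ _ cb∼b , thin-if-dot-moves 𝔸 d axioms c b cb≢c
  where
  open Theory 𝔸
  open IsCongruence congruence

  cb∼b : [ θ ] d ⟨ c , b ⟩ ∼ b
  cb∼b = transitive _ _ _
    (binary-compatible 𝔸 congruence d (symmetric a c a∼c) (reflexive b gen₂)) ab∼b

  cb≢c : d ⟨ c , b ⟩ ≢ c
  cb≢c cb≡c = a≁b (transitive _ _ _ a∼c (subst (λ z → [ θ ] z ∼ b) cb≡c cb∼b))
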